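{- Let $\mathcal{CS}$ be a pure $\mathsf{C}$-axiomatically appropriate constant specification. For any formula $A$, if $\vdash_{\mathcal{CS}}A$, then for each $\circledast\in\{1,\dots,h,\mathsf{E},\mathsf{C}\}$ there is a ground term (a term containing no proof variables) $t\in\mathrm{Tm}_\circledast$ such that $\vdash_{\mathcal{CS}} t{:}_\circledast A$.
   Context: Fix a number $h\ge 1$ of agents. Throughout, $i$ ranges over $\{1,\dots,h\}$, $*$ over $\{1,\dots,h,\mathsf{C}\}$, and $\circledast$ over $\{1,\dots,h,\mathsf{E},\mathsf{C}\}$. For each $\circledast$ let $\mathrm{Cons}_\circledast$ (proof constants) and $\mathrm{Var}_\circledast$ (proof variables) be countably infinite sets, all pairwise disjoint. Evidence terms $\mathrm{Tm}_1,\dots,\mathrm{Tm}_h,\mathrm{Tm}_{\mathsf{E}},\mathrm{Tm}_{\mathsf{C}}$ are defined by simultaneous induction: $\mathrm{Cons}_\circledast\cup\mathrm{Var}_\circledast\subseteq\mathrm{Tm}_\circledast$; if $t\in\mathrm{Tm}_i$ then $!_i t\in\mathrm{Tm}_i$; if $t,s\in\mathrm{Tm}_*$ then $t+_*s,\ t\cdot_* s\in\mathrm{Tm}_*$; if $t_1\in\mathrm{Tm}_1,\dots,t_h\in\mathrm{Tm}_h$ then $\langle t_1,\dots,t_h\rangle\in\mathrm{Tm}_{\mathsf{E}}$; if $t\in\mathrm{Tm}_{\mathsf{E}}$ then $\pi_i t\in\mathrm{Tm}_i$; if $t\in\mathrm{Tm}_{\mathsf{C}}$ then $\mathsf{hd}(t),\mathsf{tl}(t)\in\mathrm{Tm}_{\mathsf{E}}$;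 if $t\in\mathrm{Tm}_{\mathsf{C}}$ and $s\in\mathrm{Tm}_{\mathsf{E}}$ then $\mathsf{ind}(t,s)\in\mathrm{Tm}_{\mathsf{C}}$. Formulae are built from a countable set $\mathrm{Prop}$ of propositional variables using $\neg,\wedge,\vee,\to$ and the rule: if $A$ is a formula and $t\in\mathrm{Tm}_\circledast$ then $t{:}_\circledast A$ is a formula (indices on $!,+,\cdot$ omitted when clear). Axioms of $\mathsf{LP}^{\mathsf{C}}_h$ (all instances): (1) propositional tautologies; (2) $t{:}_*(A\to B)\to(s{:}_*A\to (t\cdot s){:}_*B)$; (3) $t{:}_*A\to(t+s){:}_*A$ and $s{:}_*A\to(t+s){:}_*A$; (4) $t{:}_iA\to A$; (5) $t{:}_iA\to (!t){:}_i\, t{:}_iA$; (6) $t_1{:}_1A\wedge\dots\wedge t_h{:}_hA\to\langle t_1,\dots,t_h\rangle{:}_{\mathsf{E}}A$; (7) $t{:}_{\mathsf{E}}A\to (\pi_it){:}_iA$; (8) $t{:}_{\mathsf{C}}A\to\mathsf{hd}(t){:}_{\mathsf{E}}A$ and $t{:}_{\mathsf{C}}A\to\mathsf{tl}(t){:}_{\mathsf{E}}\,t{:}_{\mathsf{C}}A$; (9) $A\wedge t{:}_{\mathsf{C}}(A\to s{:}_{\mathsf{E}}A)\to\mathsf{ind}(t,s){:}_{\mathsf{C}}A$. A constant specification $\mathcal{CS}$ is any set of formulae $c{:}_\circledast A$ with $c\in\mathrm{Cons}_\circledast$ and $A$ an axiom. It is $\mathsf{C}$-axiomatically appropriate if for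 each axiom $A$ there is $c\in\mathrm{Cons}_{\mathsf{C}}$ with $c{:}_{\mathsf{C}}A\in\mathcal{CS}$; it is pure if there is a fixed $\circledast$ with $\mathcal{CS}\subseteq\{c{:}_\circledast A: c\in\mathrm{Cons}_\circledast, A \text{ an axiom}\}$. $\mathsf{LP}^{\mathsf{C}}_h(\mathcal{CS})$ is the Hilbert system with these axioms, modus ponens, and axiom necessitation (derive $c{:}_\circledast A$ whenever $c{:}_\circledast A\in\mathcal{CS}$); $\vdash_{\mathcal{CS}}A$ means $A$ is derivable in it. -}

module Defs where

open import Data.Nat using (ℕ)
open import Data.Fin using (Fin)
open import Data.Bool using (Bool; true; false; not; _∧_; _∨_)
open import Data.Product using (Σ; ∃; _×_; _,_)
open import Relation.Binary.PropositionalEquality using (_≡_)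
open import Data.List using (List; []; _∷_; map; allFin)

data Sort (h : ℕ) : Set where
  ag : Fin h → Sort h
  E  : Sort h
  C  : Sort h

data Star {h : ℕ} : Sort h → Set where
  star-ag : (i : Fin h) → Star (ag i)
  star-C  : Star C

-- Evidence terms.  Cons_⊛ and Var_⊛ are countably infinite and pairwise
-- disjoint: they are represented by ℕ, tagged by the sort index and by the
-- constructor (cns vs var).

data Tm (h : ℕ) : Sort h → Set where
  cns  : ∀ {s} → ℕ → Tm h s
  var  : ∀ {s} → ℕ → Tm h s
  !_   : ∀ {i} → Tm h (ag i) → Tm h (ag i)
  plus : ∀ {s} → Star s → Tm h s → Tm h s → Tm h s
  app  : ∀ {s} → Star s → Tm h s → Tm h s → Tm h s
  ⟨_⟩  : ((i : Fin h) → Tm h (ag i)) → Tm h E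
  π    : (i : Fin h) → Tm h E → Tm h (ag i)
  hd   : Tm h C → Tm h E
  tl   : Tm h C → Tm h E
  ind  : Tm h C → Tm h E → Tm h C

data Ground {h : ℕ} : ∀ {s} → Tm h s → Set where
  g-cns  : ∀ {s} (c : ℕ) → Ground {s = s} (cns c)
  g-!    : ∀ {i} {t : Tm h (ag i)} → Ground t → Ground (! t)
  g-plus : ∀ {s} (st : Star s) {t u : Tm h s} → Ground t → Ground u → Ground (plus st t u)
  g-app  : ∀ {s} (st : Star s) {t u : Tm h s} → Ground t → Ground u → Ground (app st t u)
  g-⟨⟩   : {ts : (i : Fin h) → Tm h (ag i)} → ((i : Fin h) → Ground (ts i)) → Ground ⟨ ts ⟩
  g-π    : (i : Fin h) {t : Tm h E} → Ground t → Ground (π i t)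
  g-hd   : {t : Tm h C} → Ground t → Ground (hd t)
  g-tl   : {t : Tm h C} → Ground t → Ground (tl t)
  g-ind  : {t : Tm h C} {u : Tm h E} → Ground t → Ground u → Ground (ind t u)

data Fm (h : ℕ) : Set where
  atom : ℕ → Fm h
  ¬'   : Fm h → Fm h
  _∧'_ : Fm h → Fm h → Fm h
  _∨'_ : Fm h → Fm h → Fm h
  _⇒_  : Fm h → Fm h → Fm h
  jst  : ∀ {s} → Tm h s → Fm h → Fm h

infixr 5 _⇒_

-- Propositional tautologies: true under every Boolean valuation in which
-- propositional variables and justification formulas t:A are atoms.

eval : ∀ {h} → (ℕ → Bool) → (∀ {s} → Tm h s → Fm h → Bool) → Fm h → Bool
eval v w (atom p)  = v p
eval v w (¬' A)    = not (eval v w A)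
eval v w (A ∧' B)  = eval v w A ∧ eval v w B
eval v w (A ∨' B)  = eval v w A ∨ eval v w B
eval v w (A ⇒ B)   = not (eval v w A) ∨ eval v w B
eval v w (jst t A) = w t A

Tautology : ∀ {h} → Fm h → Set
Tautology {h} A = (v : ℕ → Bool) (w : ∀ {s} → Tm h s → Fm h → Bool) → eval v w A ≡ true

-- Right-nested conjunction of a nonempty list (the [] case is never used
-- since h ≥ 1; it is set to the tautology atom 0 ⇒ atom 0).
⋀ : ∀ {h} → List (Fm h) → Fm h
⋀ []           = atom 0 ⇒ atom 0
⋀ (A ∷ [])     = A
⋀ (A ∷ B ∷ As) = A ∧' ⋀ (B ∷ As)

conjAll : ∀ {h} → ((i : Fin h) → Tm h (ag i)) → Fm h → Fm h
conjAll {h} ts A = ⋀ (map (λ i → jst (ts i) A) (allFin h))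

data Axiom {h : ℕ} : Fm h → Set where
  ax-taut : ∀ {A} → Tautology A → Axiom A
  ax-app  : ∀ {s} (st : Star s) (t u : Tm h s) (A B : Fm h) →
            Axiom (jst t (A ⇒ B) ⇒ (jst u A ⇒ jst (app st t u) B))
  ax-sumˡ : ∀ {s} (st : Star s) (t u : Tm h s) (A : Fm h) →
            Axiom (jst t A ⇒ jst (plus st t u) A)
  ax-sumʳ : ∀ {s} (st : Star s) (t u : Tm h s) (A : Fm h) →
            Axiom (jst u A ⇒ jst (plus st t u) A)
  ax-refl : ∀ {i} (t : Tm h (ag i)) (A : Fm h) → Axiom (jst t A ⇒ A)
  ax-pos  : ∀ {i} (t : Tm h (ag i)) (A : Fm h) → Axiom (jst t A ⇒ jst (! t) (jst t A))
  ax-E    : (ts : (i : Fin h) → Tm h (ag i)) (A : Fm h) →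
            Axiom (conjAll ts A ⇒ jst ⟨ ts ⟩ A)
  ax-π    : (i : Fin h) (t : Tm h E) (A : Fm h) → Axiom (jst t A ⇒ jst (π i t) A)
  ax-hd   : (t : Tm h C) (A : Fm h) → Axiom (jst t A ⇒ jst (hd t) A)
  ax-tl   : (t : Tm h C) (A : Fm h) → Axiom (jst t A ⇒ jst (tl t) (jst t A))
  ax-ind  : (t : Tm h C) (u : Tm h E) (A : Fm h) →
            Axiom ((A ∧' jst t (A ⇒ jst u A)) ⇒ jst (ind t u) A)

-- Constant specifications: a set of formulae c:_⊛A with c ∈ Cons_⊛ and A an
-- axiom.  Represented as a predicate CS ⊛ c A meaning (c:_⊛ A) ∈ CS.

CSpec : ℕ → Set₁
CSpec h = (s : Sort h) → ℕ → Fm h → Set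

IsConstSpec : ∀ {h} → CSpec h → Set
IsConstSpec {h} CS = ∀ (s : Sort h) c A → CS s c A → Axiom A

C-AxiomaticallyAppropriate : ∀ {h} → CSpec h → Set
C-AxiomaticallyAppropriate {h} CS = ∀ (A : Fm h) → Axiom A → ∃ λ c → CS C c A

Pure : ∀ {h} → CSpec h → Set
Pure {h} CS = Σ (Sort h) λ s₀ → ∀ (s : Sort h) c A → CS s c A → s ≡ s₀

data _⊢_ {h : ℕ} (CS : CSpec h) : Fm h → Set where
  axiom : ∀ {A} → Axiom A → CS ⊢ A
  mp    : ∀ {A B} → CS ⊢ (A ⇒ B) → CS ⊢ A → CS ⊢ B
  nec   : ∀ {s c A} → CS s c A → CS ⊢ jst {s = s} (cns c) A

-- Every theorem has ground C-evidence, by induction on derivations: axioms get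
-- C-constants by appropriateness, modus ponens becomes application, and purity
-- forces every necessitated constant c:_C A to be of sort C.  For such c the
-- induction axiom, fed with c:_C A and a constant d certifying the axiom
-- c:_C A → tl(c):_E c:_C A, yields ground C-evidence ind(d, tl c) for c:_C A.
-- Evidence for the other sorts is then extracted with hd and π_i.
module Submission where

open import Defs
open import Data.Nat using (ℕ; _≥_)
open import Data.Product using (Σ; _×_; _,_)
open import Data.Bool using (Bool; true; false; not; _∧_; _∨_)
open import Relation.Binary.PropositionalEquality using (_≡_; refl; sym; trans)

GroundEvidence : ∀ {h} → CSpec h → Sort h → Fm h → Set
GroundEvidence {h} CS s A = Σ (Tm h s) (λ t → Ground t × CS ⊢ jst t A)

∧-intro-tautology : ∀ {h} (A B : Fm h) → Tautology (A ⇒ B ⇒ (A ∧' B))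
∧-intro-tautology A B v w = ∧-intro-bool (eval v w A) (eval v w B)
  where
  ∧-intro-bool : (x y : Bool) → (not x ∨ (not y ∨ (x ∧ y))) ≡ true
  ∧-intro-bool true  true  = refl
  ∧-intro-bool true  false = refl
  ∧-intro-bool false _     = refl

module _ {h : ℕ} {CS : CSpec h} where

  ∧-intro : ∀ {A B} → CS ⊢ A → CS ⊢ B → CS ⊢ (A ∧' B)
  ∧-intro {A} {B} ⊢A ⊢B = mp (mp (axiom (ax-taut (∧-intro-tautology A B))) ⊢A) ⊢B

  app-evidence : ∀ {s A B} → Star s → GroundEvidence CS s (A ⇒ B) →
                 GroundEvidence CS s A → GroundEvidence CS s B
  app-evidence {A = A} {B} st (t , ground-t , ⊢t) (u , ground-u , ⊢u) =
    app st t u , g-app st ground-t ground-u ,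
    mp (mp (axiom (ax-app st t u A B)) ⊢t) ⊢u

  axiom-evidence : C-AxiomaticallyAppropriate CS → ∀ {A} → Axiom A →
                   GroundEvidence CS C A
  axiom-evidence appropriate {A} ax with appropriate A ax
  ... | c , c∈CS = cns c , g-cns c , nec c∈CS

  induction-evidence : ∀ {A} {u : Tm h E} → Ground u → CS ⊢ A →
                       GroundEvidence CS C (A ⇒ jst u A) → GroundEvidence CS C A
  induction-evidence {A} {u} ground-u ⊢A (t , ground-t , ⊢t) =
    ind t u , g-ind ground-t ground-u ,
    mp (axiom (ax-ind t u A)) (∧-intro ⊢A ⊢t)

  constant-evidence : C-AxiomaticallyAppropriate CS → ∀ {c A} → CS C c A →
                      GroundEvidence CS C (jst {s = C} (cns c) A)
  constant-evidence appropriate {c} {A} c∈CS =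
    induction-evidence (g-tl (g-cns c)) (nec c∈CS)
      (axiom-evidence appropriate (ax-tl (cns c) A))

  internalisation-C : C-AxiomaticallyAppropriate CS →
                      (∀ s c A → CS s c A → s ≡ C) →
                      ∀ {A} → CS ⊢ A → GroundEvidence CS C A
  internalisation-C appropriate _ (axiom ax) = axiom-evidence appropriate ax
  internalisation-C appropriate only-C (mp ⊢A⇒B ⊢A) =
    app-evidence star-C (internalisation-C appropriate only-C ⊢A⇒B)
                        (internalisation-C appropriate only-C ⊢A)
  internalisation-C appropriate only-C (nec {s} {c} {A} c∈CS) =
    constant-of-sort-C (only-C s c A c∈CS) c∈CS
    where
    constant-of-sort-C : ∀ {s} → s ≡ C → CS s c A →
                         GroundEvidence CS C (jst {s = s} (cns c) A)
    constant-of-sort-C refl = constant-evidence appropriate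

  pure-appropriate⇒only-C : Pure CS → C-AxiomaticallyAppropriate CS →
                             ∀ s c A → CS s c A → s ≡ C
  -- ax-hd is an axiom mentioning no agent.
  pure-appropriate⇒only-C (s₀ , only-s₀) appropriate s c A c∈CS
    with appropriate _ (ax-hd (cns 0) (atom 0))
  ... | _ , d∈CS = trans (only-s₀ s c A c∈CS) (sym (only-s₀ C _ _ d∈CS))

  C-evidence⇒evidence : ∀ {A} → GroundEvidence CS C A →
                        (s : Sort h) → GroundEvidence CS s A
  C-evidence⇒evidence e C = e
  C-evidence⇒evidence {A} (t , ground-t , ⊢t) E =
    hd t , g-hd ground-t , mp (axiom (ax-hd t A)) ⊢t
  C-evidence⇒evidence {A} e (ag i) with C-evidence⇒evidence e E
  ... | t , ground-t , ⊢t = π i t , g-π i ground-t , mp (axiom (ax-π i t A)) ⊢t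

corollary1 : (h : ℕ) → h ≥ 1 → (CS : CSpec h) → IsConstSpec CS →
             Pure CS → C-AxiomaticallyAppropriate CS →
             (A : Fm h) → CS ⊢ A →
             (s : Sort h) → Σ (Tm h s) (λ t → Ground t × CS ⊢ jst t A)
corollary1 h _ CS _ pure appropriate A ⊢A =
  C-evidence⇒evidence
    (internalisation-C appropriate (pure-appropriate⇒only-C pure appropriate) ⊢A)
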